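{- Let $T_1$ and $T_2$ be two distinct heap-ordered trees (with disjoint node sets), let $v$ be a node of $T_1$ and $w$ a node of $T_2$, and let $T$ be the tree produced by $\mathit{merge}(v,w)$. Let $T_1'$ and $T_2'$ be rooted trees equivalent to $T_1$ and $T_2$, respectively, and let $T'$ be the tree obtained from $T_1'$ and $T_2'$ by rerooting $T_1'$ at $v$ and adding the arc $(v,w)$ (making $w$ the parent of $v$). Then $T'$ is equivalent to $T$.
   Context: A heap-ordered tree is a rooted tree whose nodes are distinct elements of a totally ordered set, with every non-root node greater than its parent. $\mathit{merge}(v,w)$: letting $P$ and $Q$ be the paths from $v$ and $w$ to the roots of their trees, every node $z\in P\cup Q$ gets as its new parent the largest node of $P\cup Q$ smaller than $z$ (no parent if none), while all other nodes keep their parents. For a tree $S$ and nodes $a,b$ of $S$, $S[a,b]$ denotes the set of nodes on the unique path connecting $a$ and $b$ in $S$, ignoring arc directions. Two rooted trees $S$ and $S'$ (whose nodes come from a totally ordered set; $S'$ need not be heap-ordered) are equivalent if they have the same node set and $\min(S[a,b])=\min(S'[a,b])$ for all nodes $a,b$. Rerooting a tree at $v$ means reversing the direction of every arc on the path from $v$ to the root, so that $v$ becomes the root. -}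

module Defs where

open import Data.Nat using (ℕ)
open import Data.Maybe using (Maybe; just; nothing)
open import Data.List using (List; []; _∷_; _++_)
open import Data.List.Membership.Propositional using (_∈_; _∉_)
open import Data.List.Relation.Unary.All using (All)
open import Data.List.Relation.Unary.Unique.Propositional using (Unique)
open import Data.Product using (Σ; ∃; _×_; _,_)
open import Data.Sum using (_⊎_)
open import Relation.Nullary using (¬_)
open import Relation.Binary.PropositionalEquality using (_≡_)
open import Function.Bundles using (_⇔_)

module Trees {A : Set} (_<_ : A → A → Set) where

  -- A rooted tree given by its finite node set and its parent map
  -- (the parent map is only meaningful on the nodes; nothing = root).
  record RTree : Set where
    constructor mkRTree
    field
      nodes  : List A
      parent : A → Maybe A
  open RTree public

  up : RTree → ℕ → A → Maybe A
  up S ℕ.zero    x = just x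
  up S (ℕ.suc k) x with parent S x
  ... | nothing = nothing
  ... | just y  = up S k y

  record IsRootedTree (S : RTree) : Set where
    field
      distinct   : Unique (nodes S)
      parentNode : ∀ x y → x ∈ nodes S → parent S x ≡ just y → y ∈ nodes S
      root       : A
      rootNode   : root ∈ nodes S
      rootNoPar  : parent S root ≡ nothing
      reachRoot  : ∀ x → x ∈ nodes S → ∃ λ k → up S k x ≡ just root

  IsHeapOrdered : RTree → Set
  IsHeapOrdered S = IsRootedTree S ×
    (∀ x y → x ∈ nodes S → parent S x ≡ just y → y < x)

  data RootPath (S : RTree) : A → List A → Set where
    atRoot : ∀ {x} → parent S x ≡ nothing → RootPath S x (x ∷ [])
    stepUp : ∀ {x y ys} → parent S x ≡ just y → RootPath S y ys → RootPath S x (x ∷ ys)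

  Adj : RTree → A → A → Set
  Adj S a c = a ∈ nodes S × c ∈ nodes S × (parent S a ≡ just c ⊎ parent S c ≡ just a)

  data Walk (S : RTree) : A → A → List A → Set where
    here : ∀ {a} → a ∈ nodes S → Walk S a a (a ∷ [])
    step : ∀ {a c b ps} → Adj S a c → Walk S c b ps → Walk S a b (a ∷ ps)

  -- S[a,b]: ps lists the nodes of a simple path from a to b in S
  -- (in a tree this path is unique)
  TPath : RTree → A → A → List A → Set
  TPath S a b ps = Walk S a b ps × Unique ps

  _≤_ : A → A → Set
  x ≤ y = x ≡ y ⊎ x < y

  IsMin : List A → A → Set
  IsMin ps m = m ∈ ps × All (λ y → m ≤ y) ps

  Equivalent : RTree → RTree → Set
  Equivalent S S' =
    (∀ x → (x ∈ nodes S) ⇔ (x ∈ nodes S')) ×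
    (∀ a b ps qs m → TPath S a b ps → TPath S' a b qs → (IsMin ps m ⇔ IsMin qs m))

  LargestBelow : List A → A → A → Set
  LargestBelow L z y = y ∈ L × y < z × (∀ y' → y' ∈ L → y' < z → y' ≤ y)

  record IsMerge (T1 T2 : RTree) (v w : A) (T : RTree) : Set where
    field
      mNodes   : nodes T ≡ nodes T1 ++ nodes T2
      keep₁    : ∀ P Q → RootPath T1 v P → RootPath T2 w Q →
                   ∀ z → z ∈ nodes T1 → z ∉ P ++ Q → parent T z ≡ parent T1 z
      keep₂    : ∀ P Q → RootPath T1 v P → RootPath T2 w Q →
                   ∀ z → z ∈ nodes T2 → z ∉ P ++ Q → parent T z ≡ parent T2 z
      relink   : ∀ P Q → RootPath T1 v P → RootPath T2 w Q →
                   ∀ z y → z ∈ P ++ Q → LargestBelow (P ++ Q) z y → parent T z ≡ just y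
      unlink   : ∀ P Q → RootPath T1 v P → RootPath T2 w Q →
                   ∀ z → z ∈ P ++ Q → (∀ y → y ∈ P ++ Q → ¬ (y < z)) → parent T z ≡ nothing

  record IsRerootLink (T1' T2' : RTree) (v w : A) (T' : RTree) : Set where
    field
      rNodes  : nodes T' ≡ nodes T1' ++ nodes T2'
      keepT₂  : ∀ z → z ∈ nodes T2' → parent T' z ≡ parent T2' z
      keepT₁  : ∀ R → RootPath T1' v R →
                  ∀ z → z ∈ nodes T1' → z ∉ R → parent T' z ≡ parent T1' z
      reverse : ∀ R → RootPath T1' v R →
                  ∀ x z → x ∈ R → parent T1' x ≡ just z → parent T' z ≡ just x
      linkVW  : parent T' v ≡ just w

module Submission where

-- In a forest, min(S[a,b]) is the largest t such that a and b are joined by a path through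
-- nodes ≥ t, so two acyclic trees on the same nodes are equivalent as soon as they have the same
-- "joined above t" relations, and this can be checked one arc at a time.  Every arc of T off the
-- root paths P of v and Q of w is an arc of T1 or T2, and every arc of T' other than (v,w) is a
-- possibly reversed arc of T1' or T2'; the equivalences transfer these.  On P ∪ Q, merge links
-- every node to the next smaller one, so any two of these nodes are joined in T above their
-- minimum; the same holds in T', where by heap order each x ∈ P is joined to v above x (and each
-- x ∈ Q to w), and v is linked to w.  Finally T is acyclic because parents decrease, and T'
-- because every node reaches v, then w, then the root of T2'.

open import Defs
open import Level using (0ℓ)
open import Relation.Binary.Core using (Rel)
open import Relation.Binary.Structures using (IsStrictTotalOrder)
open import Relation.Binary.PropositionalEquality using (_≡_; refl; sym; trans; cong; subst; module ≡-Reasoning)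
open import Data.List.Membership.Propositional using (_∈_; _∉_)

open import Data.Nat as ℕ using (ℕ; zero; suc)
import Data.Nat.Properties as ℕ
open import Data.Maybe using (just; nothing; _>>=_)
open import Data.Maybe.Properties using (just-injective)
open import Data.List using (List; []; _∷_; _++_)
open import Data.List.Relation.Unary.Any using (here; there)
open import Data.List.Relation.Unary.All as All using (All; []; _∷_)
open import Data.List.Relation.Unary.AllPairs using ([]; _∷_)
open import Data.List.Relation.Unary.Unique.Propositional using (Unique)
open import Data.List.Membership.Propositional.Properties using (∈-++⁺ˡ; ∈-++⁺ʳ; ∈-++⁻)
open import Data.Product using (∃; _×_; _,_; proj₁; proj₂; map₁)
open import Data.Sum using (_⊎_; inj₁; inj₂; swap)
open import Data.Empty using (⊥; ⊥-elim)
open import Data.Unit using (⊤; tt)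
open import Relation.Nullary using (¬_; Dec; yes; no)
open import Relation.Binary.Definitions using (tri<; tri≈; tri>)
open import Function.Bundles using (_⇔_; mk⇔; Equivalence)

module OrderedTrees {A : Set} (_<_ : Rel A 0ℓ) (sto : IsStrictTotalOrder _≡_ _<_) where
  open Trees _<_
  open IsStrictTotalOrder sto using (compare; _≟_; _<?_) renaming (trans to <-trans; irrefl to <-irrefl)
  open import Data.List.Membership.DecPropositional _≟_ using (_∈?_)

  <-irrefl′ : ∀ {x} → ¬ (x < x)
  <-irrefl′ = <-irrefl refl

  ≤-trans : ∀ {x y z} → x ≤ y → y ≤ z → x ≤ z
  ≤-trans (inj₁ refl) q = q
  ≤-trans (inj₂ p) (inj₁ refl) = inj₂ p
  ≤-trans (inj₂ p) (inj₂ q) = inj₂ (<-trans p q)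

  ≤-<-trans : ∀ {x y z} → x ≤ y → y < z → x < z
  ≤-<-trans (inj₁ refl) q = q
  ≤-<-trans (inj₂ p) q = <-trans p q

  ≤-antisym : ∀ {x y} → x ≤ y → y ≤ x → x ≡ y
  ≤-antisym (inj₁ e) _ = e
  ≤-antisym (inj₂ p) (inj₁ e) = sym e
  ≤-antisym (inj₂ p) (inj₂ q) = ⊥-elim (<-irrefl′ (<-trans p q))

  _≤?_ : ∀ x y → Dec (x ≤ y)
  x ≤? y with compare x y
  ... | tri< x<y _ _ = yes (inj₂ x<y)
  ... | tri≈ _ x≡y _ = yes (inj₁ x≡y)
  ... | tri> x≮y x≢y _ = no λ { (inj₁ e) → x≢y e ; (inj₂ l) → x≮y l }

  ≰⇒> : ∀ {x y} → ¬ (x ≤ y) → y < x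
  ≰⇒> {x} {y} x≰y with compare x y
  ... | tri< x<y _ _ = ⊥-elim (x≰y (inj₂ x<y))
  ... | tri≈ _ x≡y _ = ⊥-elim (x≰y (inj₁ x≡y))
  ... | tri> _ _ y<x = y<x

  nothing≢just : ∀ {x : A} → ¬ (nothing ≡ just x)
  nothing≢just ()

  up-parent : ∀ S {x y} k → parent S x ≡ just y → up S (suc k) x ≡ up S k y
  up-parent S k e rewrite e = refl

  up-root : ∀ S {x} k → parent S x ≡ nothing → up S (suc k) x ≡ nothing
  up-root S k e rewrite e = refl

  up-suc⁻ : ∀ S k {x z} → up S (suc k) x ≡ just z → ∃ λ y → parent S x ≡ just y × up S k y ≡ just z
  up-suc⁻ S k {x} h with parent S x
  ... | just y = y , refl , h

  up-+ : ∀ S m n x → up S (m ℕ.+ n) x ≡ (up S m x >>= up S n)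
  up-+ S zero n x = refl
  up-+ S (suc m) n x with parent S x
  ... | nothing = refl
  ... | just y = up-+ S m n y

  _⊆_ : List A → List A → Set
  xs ⊆ ys = ∀ {x} → x ∈ xs → x ∈ ys

  Acyclic : RTree → Set
  Acyclic S = ∀ x k → x ∈ nodes S → ¬ (up S (suc k) x ≡ just x)

  reachesRoot⇒acyclic : ∀ S r → parent S r ≡ nothing →
    (∀ x → x ∈ nodes S → ∃ λ k → up S k x ≡ just r) → Acyclic S
  reachesRoot⇒acyclic S r r-root reach x k x∈S cycle with reach x x∈S
  ... | j , x↑r = nothing≢just (begin
    nothing                      ≡⟨ up-root S k r-root ⟨
    (just r >>= up S (suc k))    ≡⟨ cong (_>>= up S (suc k)) x↑r ⟨
    (up S j x >>= up S (suc k))  ≡⟨ up-+ S j (suc k) x ⟨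
    up S (j ℕ.+ suc k) x         ≡⟨ cong (λ n → up S n x) (ℕ.+-comm j (suc k)) ⟩
    up S (suc k ℕ.+ j) x         ≡⟨ up-+ S (suc k) j x ⟩
    (up S (suc k) x >>= up S j)  ≡⟨ cong (_>>= up S j) cycle ⟩
    up S j x                     ≡⟨ x↑r ⟩
    just r                       ∎)
    where open ≡-Reasoning

  rootedTree⇒acyclic : ∀ {S} → IsRootedTree S → Acyclic S
  rootedTree⇒acyclic {S} rt = reachesRoot⇒acyclic S root rootNoPar reachRoot
    where open IsRootedTree rt

  data Connected (S : RTree) (Q : A → Set) : A → A → Set where
    node  : ∀ {a} → a ∈ nodes S → Q a → Connected S Q a a
    edge  : ∀ {a c} → Adj S a c → Q a → Q c → Connected S Q a c
    flip  : ∀ {a c} → Connected S Q c a → Connected S Q a c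
    _⨾_   : ∀ {a b c} → Connected S Q a b → Connected S Q b c → Connected S Q a c

  infixr 5 _⨾_

  Above : RTree → A → A → A → Set
  Above S t = Connected S (t ≤_)

  Connected-ends : ∀ {S Q a b} → Connected S Q a b → Q a × Q b
  Connected-ends (node _ q) = q , q
  Connected-ends (edge _ qa qc) = qa , qc
  Connected-ends (flip c) = proj₂ (Connected-ends c) , proj₁ (Connected-ends c)
  Connected-ends (c ⨾ d) = proj₁ (Connected-ends c) , proj₂ (Connected-ends d)

  Connected-map : ∀ {S S' Q Q'} → (∀ {a} → a ∈ nodes S → Q a → Connected S' Q' a a) →
    (∀ {a c} → Adj S a c → Q a → Q c → Connected S' Q' a c) →
    ∀ {a b} → Connected S Q a b → Connected S' Q' a b
  Connected-map f g (node a∈S q) = f a∈S q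
  Connected-map f g (edge adj qa qc) = g adj qa qc
  Connected-map f g (flip c) = flip (Connected-map f g c)
  Connected-map f g (c ⨾ d) = Connected-map f g c ⨾ Connected-map f g d

  Connected-weaken : ∀ {S Q Q'} → (∀ {y} → Q y → Q' y) → ∀ {a b} → Connected S Q a b → Connected S Q' a b
  Connected-weaken f = Connected-map (λ a∈S q → node a∈S (f q)) (λ adj qa qc → edge adj (f qa) (f qc))

  Above⊆ : RTree → RTree → Set
  Above⊆ S S' = ∀ {t a b} → Above S t a b → Above S' t a b

  ArcsAbove : RTree → RTree → Set
  ArcsAbove S S' = ∀ {t a c} → a ∈ nodes S → c ∈ nodes S → parent S a ≡ just c → t ≤ a → t ≤ c → Above S' t a c

  arc : ∀ {S} → ArcsAbove S S
  arc a∈S c∈S a↑c t≤a t≤c = edge (a∈S , c∈S , inj₁ a↑c) t≤a t≤c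

  tree-arc : ∀ {S t a c} → IsRootedTree S → a ∈ nodes S → parent S a ≡ just c → t ≤ a → t ≤ c → Above S t a c
  tree-arc rt a∈S a↑c = arc a∈S (IsRootedTree.parentNode rt _ _ a∈S a↑c) a↑c

  Above-lift : ∀ {S S'} → nodes S ⊆ nodes S' → ArcsAbove S S' → Above⊆ S S'
  Above-lift {S} {S'} S⊆S' lift-arc = Connected-map (λ a∈S q → node (S⊆S' a∈S) q) lift-edge
    where
      lift-edge : ∀ {t a c} → Adj S a c → t ≤ a → t ≤ c → Above S' t a c
      lift-edge (a∈S , c∈S , inj₁ a↑c) t≤a t≤c = lift-arc a∈S c∈S a↑c t≤a t≤c
      lift-edge (a∈S , c∈S , inj₂ c↑a) t≤a t≤c = flip (lift-arc c∈S a∈S c↑a t≤c t≤a)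

  Adj-sym : ∀ {S a c} → Adj S a c → Adj S c a
  Adj-sym (a∈S , c∈S , e) = c∈S , a∈S , swap e

  Walk-head : ∀ {S a b ps} → Walk S a b ps → a ∈ ps
  Walk-head (here _) = here refl
  Walk-head (step _ _) = here refl

  walk⇒connected : ∀ {S Q a b ps} → Walk S a b ps → All Q ps → Connected S Q a b
  walk⇒connected (here a∈S) (q ∷ _) = node a∈S q
  walk⇒connected (step adj w) (q ∷ qs) =
    edge adj q (All.lookup qs (Walk-head w)) ⨾ walk⇒connected w qs

  WalkWithin : RTree → (A → Set) → A → A → Set
  WalkWithin S Q a b = ∃ λ ps → Walk S a b ps × All Q ps

  walk-++ : ∀ {S Q a b c} → WalkWithin S Q a b → WalkWithin S Q b c → WalkWithin S Q a c
  walk-++ (_ , here _ , _) w = w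
  walk-++ (_ , step adj w₁ , q ∷ qs) w₂ with walk-++ (_ , w₁ , qs) w₂
  ... | _ , w , qs' = _ , step adj w , q ∷ qs'

  walk-reverse : ∀ {S Q a b} → WalkWithin S Q a b → WalkWithin S Q b a
  walk-reverse w@(_ , here _ , _) = w
  walk-reverse (_ , step adj w , q ∷ qs) =
    walk-++ (walk-reverse (_ , w , qs))
            (_ , step (Adj-sym adj) (here (proj₁ adj)) , All.lookup qs (Walk-head w) ∷ q ∷ [])

  connected⇒walk : ∀ {S Q a b} → Connected S Q a b → WalkWithin S Q a b
  connected⇒walk (node a∈S q) = _ , here a∈S , q ∷ []
  connected⇒walk (edge adj qa qc) = _ , step adj (here (proj₁ (proj₂ adj))) , qa ∷ qc ∷ []
  connected⇒walk (flip c) = walk-reverse (connected⇒walk c)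
  connected⇒walk (c ⨾ d) = walk-++ (connected⇒walk c) (connected⇒walk d)

  SimpleWalkWithin : RTree → A → A → List A → Set
  SimpleWalkWithin S a b ps = ∃ λ qs → TPath S a b qs × qs ⊆ ps

  walk-drop : ∀ {S a b qs c} → Walk S a b qs → Unique qs → c ∈ qs → SimpleWalkWithin S c b qs
  walk-drop w@(here _) u (here refl) = _ , (w , u) , λ p → p
  walk-drop w@(step _ _) u (here refl) = _ , (w , u) , λ p → p
  walk-drop (step adj w) (_ ∷ u) (there c∈) with walk-drop w u c∈
  ... | rs , tp , rs⊆ = rs , tp , λ p → there (rs⊆ p)

  walk⇒tpath : ∀ {S a b ps} → Walk S a b ps → SimpleWalkWithin S a b ps
  walk⇒tpath (here a∈S) = _ , (here a∈S , [] ∷ []) , λ p → p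
  walk⇒tpath {a = a} (step adj w) with walk⇒tpath w
  ... | qs , (w' , u) , qs⊆ with a ∈? qs
  ...   | yes a∈qs = let rs , tp , rs⊆ = walk-drop w' u a∈qs in rs , tp , λ p → there (qs⊆ (rs⊆ p))
  ...   | no a∉qs =
    a ∷ qs , (step adj w' , All.tabulate (λ y∈ a≡y → a∉qs (subst (_∈ qs) (sym a≡y) y∈)) ∷ u) ,
    λ { (here e) → here e ; (there p) → there (qs⊆ p) }

  connected⇒tpath : ∀ {S Q a b} → Connected S Q a b → ∃ λ ps → TPath S a b ps × All Q ps
  connected⇒tpath c with connected⇒walk c
  ... | ps , w , qs with walk⇒tpath w
  ... | rs , tp , rs⊆ = rs , tp , All.tabulate (λ p → All.lookup qs (rs⊆ p))

  up⇒connected : ∀ {S} → IsRootedTree S → ∀ k {x r} → x ∈ nodes S → up S k x ≡ just r → Connected S (λ _ → ⊤) x r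
  up⇒connected rt zero x∈S refl = node x∈S tt
  up⇒connected {S} rt (suc k) x∈S h with up-suc⁻ S k h
  ... | y , e , h' = edge (x∈S , y∈S , inj₁ e) tt tt ⨾ up⇒connected rt k y∈S h'
    where y∈S = IsRootedTree.parentNode rt _ _ x∈S e

  tpath-exists : ∀ {S} → IsRootedTree S → ∀ {a b} → a ∈ nodes S → b ∈ nodes S → ∃ λ ps → TPath S a b ps
  tpath-exists {S} rt {a} {b} a∈S b∈S
    with IsRootedTree.reachRoot rt a a∈S | IsRootedTree.reachRoot rt b b∈S
  ... | j , a↑ | k , b↑ =
    let ps , tp , _ = connected⇒tpath (up⇒connected rt j a∈S a↑ ⨾ flip (up⇒connected rt k b∈S b↑))
    in ps , tp

  Descendant : RTree → A → A → Set
  Descendant S c y = ∃ λ k → up S k y ≡ just c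

  Avoiding : A → A → Set
  Avoiding x y = ¬ y ≡ x

  descendant-step : ∀ S {c x y y'} → parent S c ≡ just x → Adj S y y' → Avoiding x y → Avoiding x y' →
    Descendant S c y → Descendant S c y'
  descendant-step S c↑x (_ , _ , inj₂ y'↑y) _ _ (k , h) = suc k , trans (up-parent S k y'↑y) h
  descendant-step S c↑x (_ , _ , inj₁ y↑y') _ y'≢x (zero , refl) =
    ⊥-elim (y'≢x (just-injective (trans (sym y↑y') c↑x)))
  descendant-step S c↑x (_ , _ , inj₁ y↑y') _ _ (suc k , h) = k , trans (sym (up-parent S k y↑y')) h

  -- Removing the arc from c to its parent x separates the descendants of c from the rest.
  descendant-connected : ∀ S {c x a b} → parent S c ≡ just x → Connected S (Avoiding x) a b →
    Descendant S c a ⇔ Descendant S c b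
  descendant-connected S c↑x (node _ _) = mk⇔ (λ d → d) (λ d → d)
  descendant-connected S c↑x (edge adj qa qc) =
    mk⇔ (descendant-step S c↑x adj qa qc) (descendant-step S c↑x (Adj-sym adj) qc qa)
  descendant-connected S c↑x (flip c) =
    let e = descendant-connected S c↑x c in mk⇔ (Equivalence.from e) (Equivalence.to e)
  descendant-connected S c↑x (c ⨾ d) =
    let e₁ = descendant-connected S c↑x c ; e₂ = descendant-connected S c↑x d
    in mk⇔ (λ z → Equivalence.to e₂ (Equivalence.to e₁ z)) (λ z → Equivalence.from e₁ (Equivalence.from e₂ z))

  -- a, b and then q all descend from p, so the arc between x and q closes a cycle through p.
  no-cut : ∀ S {p x q a b} → Acyclic S → p ∈ nodes S → parent S p ≡ just x → Adj S x q → ¬ q ≡ p →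
    Connected S (Avoiding x) a p → Connected S (Avoiding x) q b → Connected S (Avoiding x) a b → ⊥
  no-cut S {p} {x} {q} acyclic p∈S p↑x x~q q≢p a~p q~b a~b = close-cycle x~q q-below-p
    where
      below : ∀ {y z} → Connected S (Avoiding x) y z → Descendant S p y ⇔ Descendant S p z
      below = descendant-connected S p↑x
      q-below-p : Descendant S p q
      q-below-p = Equivalence.from (below q~b)
                    (Equivalence.to (below a~b) (Equivalence.from (below a~p) (zero , refl)))
      close-cycle : Adj S x q → Descendant S p q → ⊥
      close-cycle _ (zero , h) = q≢p (just-injective h)
      close-cycle (_ , _ , inj₁ x↑q) (suc k , h) =
        acyclic p (suc (suc k)) p∈S
          (trans (up-parent S (suc (suc k)) p↑x) (trans (up-parent S (suc k) x↑q) h))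
      close-cycle (_ , _ , inj₂ q↑x) (suc k , h) =
        acyclic p k p∈S (trans (up-parent S k p↑x) (trans (sym (up-parent S k q↑x)) h))

  record Straddle (S : RTree) (a b x : A) : Set where
    field
      before after   : A
      prefix suffix  : List A
      prefix-walk    : Walk S a before prefix
      x∉prefix       : x ∉ prefix
      before~x       : Adj S before x
      x~after        : Adj S x after
      suffix-walk    : Walk S after b suffix
      x∉suffix       : x ∉ suffix
      before≢after   : ¬ before ≡ after

  straddle-start : ∀ {S a x b ps} → Adj S a x → Walk S x b ps → All (λ y → ¬ a ≡ y) ps → Unique ps →
    ¬ x ≡ a → ¬ x ≡ b → Straddle S a b x
  straddle-start adj (here _) _ _ _ x≢b = ⊥-elim (x≢b refl)
  straddle-start {a = a} adj (step adj' w) (_ ∷ a∉ps) (x∉ps ∷ _) x≢a _ = record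
    { before = a ; after = _ ; prefix = a ∷ [] ; suffix = _
    ; prefix-walk = here (proj₁ adj) ; x∉prefix = λ { (here e) → x≢a e }
    ; before~x = adj ; x~after = adj' ; suffix-walk = w
    ; x∉suffix = λ x∈ → All.lookup x∉ps x∈ refl
    ; before≢after = All.lookup a∉ps (Walk-head w) }

  straddle-extend : ∀ {S a c b x} → Straddle S c b x → Adj S a c → ¬ x ≡ a → Straddle S a b x
  straddle-extend {a = a} s adj x≢a = record
    { before = before ; after = after ; prefix = a ∷ prefix ; suffix = suffix
    ; prefix-walk = step adj prefix-walk ; x∉prefix = λ { (here e) → x≢a e ; (there i) → x∉prefix i }
    ; before~x = before~x ; x~after = x~after ; suffix-walk = suffix-walk ; x∉suffix = x∉suffix
    ; before≢after = before≢after }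
    where open Straddle s

  straddle : ∀ {S a b ps x} → TPath S a b ps → x ∈ ps → ¬ x ≡ a → ¬ x ≡ b → Straddle S a b x
  straddle (here _ , _) (here e) x≢a _ = ⊥-elim (x≢a e)
  straddle (step _ _ , _) (here e) x≢a _ = ⊥-elim (x≢a e)
  straddle {x = x} (step {c = c} adj w , a∉ps ∷ u) (there x∈) x≢a x≢b with x ≟ c
  ... | yes refl = straddle-start adj w a∉ps u x≢a x≢b
  ... | no x≢c = straddle-extend (straddle (w , u) x∈ x≢c x≢b) adj x≢a

  ∉⇒avoiding : ∀ {x ps} → x ∉ ps → All (Avoiding x) ps
  ∉⇒avoiding {ps = ps} x∉ = All.tabulate (λ y∈ y≡x → x∉ (subst (_∈ ps) y≡x y∈))

  -- A node x < t on the path would be a cut vertex separating its two neighbours on it.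
  tpath-above : ∀ {S t a b ps} → Acyclic S → TPath S a b ps → Above S t a b → All (t ≤_) ps
  tpath-above {S} {t} {a} {b} {ps} acyclic tp a~b = All.tabulate above
    where
      above : ∀ {x} → x ∈ ps → t ≤ x
      above {x} x∈ with t ≤? x
      ... | yes t≤x = t≤x
      ... | no t≰x = ⊥-elim (no-cut-at before~x x~after)
        where
          avoid : ∀ {y} → t ≤ y → Avoiding x y
          avoid t≤y y≡x = t≰x (subst (t ≤_) y≡x t≤y)
          open Straddle (straddle tp x∈ (λ e → avoid (proj₁ (Connected-ends a~b)) (sym e))
                                        (λ e → avoid (proj₂ (Connected-ends a~b)) (sym e)))
          a~before : Connected S (Avoiding x) a before
          a~before = walk⇒connected prefix-walk (∉⇒avoiding x∉prefix)
          after~b : Connected S (Avoiding x) after b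
          after~b = walk⇒connected suffix-walk (∉⇒avoiding x∉suffix)
          a~b' : Connected S (Avoiding x) a b
          a~b' = Connected-weaken avoid a~b
          no-cut-at : Adj S before x → Adj S x after → ⊥
          no-cut-at (b∈S , _ , inj₁ before↑x) x~after' =
            no-cut S acyclic b∈S before↑x x~after' (λ e → before≢after (sym e)) a~before after~b a~b'
          no-cut-at (_ , _ , inj₂ x↑before) (_ , _ , inj₁ x↑after) =
            before≢after (just-injective (trans (sym x↑before) x↑after))
          no-cut-at before~x' (_ , a∈S , inj₂ after↑x) =
            no-cut S acyclic a∈S after↑x (Adj-sym {S} before~x') before≢after
                   (flip after~b) (flip a~before) (flip a~b')

  minimum-exists : ∀ a ps → ∃ (IsMin (a ∷ ps))
  minimum-exists a [] = a , here refl , inj₁ refl ∷ []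
  minimum-exists a (b ∷ ps) with minimum-exists b ps
  ... | m , m∈ , m≤ with a ≤? m
  ...   | yes a≤m = a , here refl , inj₁ refl ∷ All.map (≤-trans a≤m) m≤
  ...   | no a≰m = m , there m∈ , inj₂ (≰⇒> a≰m) ∷ m≤

  tpath-minimum : ∀ {S a b ps} → TPath S a b ps → ∃ (IsMin ps)
  tpath-minimum (here {a} _ , _) = minimum-exists a []
  tpath-minimum (step {a} {ps = ps} _ _ , _) = minimum-exists a ps

  -- min(S[a,b]) is the largest t such that a and b are joined above t.
  isMin-transfer : ∀ {S S' a b ps qs m} → Acyclic S → Acyclic S' → Above⊆ S S' → Above⊆ S' S →
    TPath S a b ps → TPath S' a b qs → IsMin ps m → IsMin qs m
  isMin-transfer {qs = qs} acyclic acyclic' S⊆S' S'⊆S tp tq (m∈ps , m≤ps) with tpath-minimum tq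
  ... | m' , m'∈qs , m'≤qs = subst (_∈ qs) (sym m≡m') m'∈qs , m≤qs
    where
      m≤qs = tpath-above acyclic' tq (S⊆S' (walk⇒connected (proj₁ tp) m≤ps))
      m'≤ps = tpath-above acyclic tp (S'⊆S (walk⇒connected (proj₁ tq) m'≤qs))
      m≡m' = ≤-antisym (All.lookup m≤qs m'∈qs) (All.lookup m'≤ps m∈ps)

  sameAbove⇒equivalent : ∀ {S S'} → Acyclic S → Acyclic S' → (∀ x → (x ∈ nodes S) ⇔ (x ∈ nodes S')) →
    Above⊆ S S' → Above⊆ S' S → Equivalent S S'
  sameAbove⇒equivalent acyclic acyclic' same-nodes S⊆S' S'⊆S = same-nodes , λ a b ps qs m tp tq →
    mk⇔ (isMin-transfer acyclic acyclic' S⊆S' S'⊆S tp tq) (isMin-transfer acyclic' acyclic S'⊆S S⊆S' tq tp)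

  Equivalent-sym : ∀ {S S'} → Equivalent S S' → Equivalent S' S
  Equivalent-sym (same-nodes , same-min) =
    (λ x → let e = same-nodes x in mk⇔ (Equivalence.from e) (Equivalence.to e)) ,
    λ a b ps qs m tp tq → let e = same-min a b qs ps m tq tp in mk⇔ (Equivalence.from e) (Equivalence.to e)

  -- Each edge a~c of S is joined in S' above min(S'[a,c]) = min(S[a,c]) = min(a,c).
  equivalent⇒Above⊆ : ∀ {S S'} → IsRootedTree S → IsRootedTree S' → Equivalent S S' → Above⊆ S S'
  equivalent⇒Above⊆ {S} {S'} rt rt' (same-nodes , same-min) =
    Connected-map (λ a∈S q → node (Equivalence.to (same-nodes _) a∈S) q) lift-edge
    where
      lift-edge : ∀ {t a c} → Adj S a c → t ≤ a → t ≤ c → Above S' t a c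
      lift-edge {t} {a} {c} adj@(a∈S , c∈S , _) t≤a t≤c
        with tpath-exists rt a∈S c∈S
           | tpath-exists rt' (Equivalence.to (same-nodes a) a∈S) (Equivalence.to (same-nodes c) c∈S)
      ... | ps , tp | qs , tq with tpath-minimum tp
      ... | m , m-min = walk⇒connected (proj₁ tq) (All.map (≤-trans t≤m) (proj₂ m-min'))
        where
          t≤m = All.lookup (tpath-above (rootedTree⇒acyclic rt) tp (edge adj t≤a t≤c)) (proj₁ m-min)
          m-min' = Equivalence.to (same-min a c ps qs m tp tq) m-min

  RootPath-head : ∀ {S x R} → RootPath S x R → x ∈ R
  RootPath-head (atRoot _) = here refl
  RootPath-head (stepUp _ _) = here refl

  RootPath-nodes : ∀ {S} → IsRootedTree S → ∀ {x R} → x ∈ nodes S → RootPath S x R → R ⊆ nodes S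
  RootPath-nodes rt x∈S (atRoot _) (here refl) = x∈S
  RootPath-nodes rt x∈S (stepUp _ _) (here refl) = x∈S
  RootPath-nodes rt x∈S (stepUp e r) (there y∈) = RootPath-nodes rt (IsRootedTree.parentNode rt _ _ x∈S e) r y∈

  RootPath-parent : ∀ {S x R y z} → RootPath S x R → y ∈ R → parent S y ≡ just z → z ∈ R
  RootPath-parent (atRoot e) (here refl) e' = ⊥-elim (nothing≢just (trans (sym e) e'))
  RootPath-parent (stepUp e r) (here refl) e' =
    there (subst (_∈ _) (just-injective (trans (sym e) e')) (RootPath-head r))
  RootPath-parent (stepUp e r) (there y∈) e' = there (RootPath-parent r y∈ e')

  RootPath-child : ∀ {S x R z} → RootPath S x R → z ∈ R → ¬ z ≡ x → ∃ λ y → y ∈ R × parent S y ≡ just z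
  RootPath-child (atRoot _) (here e) z≢x = ⊥-elim (z≢x e)
  RootPath-child (stepUp e r) (here e') z≢x = ⊥-elim (z≢x e')
  RootPath-child {S} {x = x} {z = z} (stepUp {y = y} e r) (there z∈) z≢x with z ≟ y
  ... | yes refl = x , here refl , e
  ... | no z≢y = let y' , y'∈ , e' = RootPath-child r z∈ z≢y in y' , there y'∈ , e'

  RootPath-ancestor : ∀ {S x R} → RootPath S x R → ∀ k {y} → up S k x ≡ just y → y ∈ R
  RootPath-ancestor r zero refl = RootPath-head r
  RootPath-ancestor {S} (atRoot e) (suc k) h = ⊥-elim (nothing≢just (trans (sym (up-root S k e)) h))
  RootPath-ancestor {S} (stepUp e r) (suc k) h = there (RootPath-ancestor r k (trans (sym (up-parent S k e)) h))

  up⇒RootPath : ∀ S {r} → parent S r ≡ nothing → ∀ k x → up S k x ≡ just r → ∃ (RootPath S x)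
  up⇒RootPath S r-root zero x refl = _ , atRoot r-root
  up⇒RootPath S r-root (suc k) x h with up-suc⁻ S k h
  ... | y , e , h' = let R , r = up⇒RootPath S r-root k y h' in _ , stepUp e r

  rootPath-exists : ∀ {S} → IsRootedTree S → ∀ {x} → x ∈ nodes S → ∃ (RootPath S x)
  rootPath-exists {S} rt {x} x∈S =
    let k , x↑ = reachRoot x x∈S in up⇒RootPath S rootNoPar k x x↑
    where open IsRootedTree rt

  heap-rootPath : ∀ {S} → IsHeapOrdered S → ∀ {v P} → v ∈ nodes S → RootPath S v P →
    ∀ {x} → x ∈ P → x ≤ v × (∀ {t} → t ≤ x → Above S t v x)
  heap-rootPath h v∈S (atRoot _) (here refl) = inj₁ refl , λ t≤x → node v∈S t≤x
  heap-rootPath h v∈S (stepUp _ _) (here refl) = inj₁ refl , λ t≤x → node v∈S t≤x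
  heap-rootPath (rt , heap) {v} v∈S (stepUp {y = p} v↑p r) (there x∈) =
    x≤v , λ t≤x → arc v∈S p∈S v↑p (≤-trans t≤x x≤v) (≤-trans t≤x x≤p) ⨾ proj₂ ih t≤x
    where
      p∈S = IsRootedTree.parentNode rt v p v∈S v↑p
      ih = heap-rootPath (rt , heap) p∈S r x∈
      x≤p = proj₁ ih
      x≤v = inj₂ (≤-<-trans x≤p (heap v p v∈S v↑p))

  ParentDecreasing : RTree → Set
  ParentDecreasing S = ∀ {a c} → a ∈ nodes S → parent S a ≡ just c → c ∈ nodes S × c < a

  heapOrdered⇒decreasing : ∀ {S} → IsHeapOrdered S → ParentDecreasing S
  heapOrdered⇒decreasing (rt , heap) a∈S a↑c = IsRootedTree.parentNode rt _ _ a∈S a↑c , heap _ _ a∈S a↑c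

  up-decreasing : ∀ {S} → ParentDecreasing S → ∀ k {x z} → x ∈ nodes S → up S (suc k) x ≡ just z → z < x
  up-decreasing {S} decr zero x∈S h with up-suc⁻ S zero h
  ... | y , e , refl = proj₂ (decr x∈S e)
  up-decreasing {S} decr (suc k) x∈S h with up-suc⁻ S (suc k) h
  ... | y , e , h' = <-trans (up-decreasing decr k (proj₁ (decr x∈S e)) h') (proj₂ (decr x∈S e))

  decreasing⇒acyclic : ∀ {S} → ParentDecreasing S → Acyclic S
  decreasing⇒acyclic decr x k x∈S cycle = <-irrefl′ (up-decreasing decr k x∈S cycle)

  largestBelow? : ∀ L z → (∃ (LargestBelow L z)) ⊎ (∀ y → y ∈ L → ¬ y < z)
  largestBelow? [] z = inj₂ λ _ ()
  largestBelow? (u ∷ L) z with largestBelow? L z | u <? z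
  ... | inj₂ none | no u≮z = inj₂ λ { _ (here refl) → u≮z ; y (there y∈) → none y y∈ }
  ... | inj₂ none | yes u<z =
    inj₁ (u , here refl , u<z , λ { _ (here refl) _ → inj₁ refl ; y (there y∈) y<z → ⊥-elim (none y y∈ y<z) })
  ... | inj₁ (y , y∈ , y<z , y-max) | no u≮z =
    inj₁ (y , there y∈ , y<z , λ { _ (here refl) u<z → ⊥-elim (u≮z u<z) ; y' (there y'∈) → y-max y' y'∈ })
  ... | inj₁ (y , y∈ , y<z , y-max) | yes u<z with u ≤? y
  ...   | yes u≤y = inj₁ (y , there y∈ , y<z , λ { _ (here refl) _ → u≤y ; y' (there y'∈) → y-max y' y'∈ })
  ...   | no u≰y = inj₁ (u , here refl , u<z ,
      λ { _ (here refl) _ → inj₁ refl ; y' (there y'∈) y'<z → inj₂ (≤-<-trans (y-max y' y'∈ y'<z) (≰⇒> u≰y)) })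

  countBelow : A → List A → ℕ
  countBelow z [] = 0
  countBelow z (u ∷ L) with u <? z
  ... | yes _ = suc (countBelow z L)
  ... | no _ = countBelow z L

  countBelow-mono : ∀ {y z} → y < z → ∀ L → countBelow y L ℕ.≤ countBelow z L
  countBelow-mono y<z [] = ℕ.z≤n
  countBelow-mono {y} {z} y<z (u ∷ L) with u <? y | u <? z
  ... | yes _ | yes _ = ℕ.s≤s (countBelow-mono y<z L)
  ... | yes u<y | no u≮z = ⊥-elim (u≮z (<-trans u<y y<z))
  ... | no _ | yes _ = ℕ.m≤n⇒m≤1+n (countBelow-mono y<z L)
  ... | no _ | no _ = countBelow-mono y<z L

  countBelow-< : ∀ {y z} → y < z → ∀ L → y ∈ L → countBelow y L ℕ.< countBelow z L
  countBelow-< {y} {z} y<z (u ∷ L) (here refl) with u <? y | u <? z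
  ... | yes u<u | _ = ⊥-elim (<-irrefl′ u<u)
  ... | no _ | yes _ = ℕ.s≤s (countBelow-mono y<z L)
  ... | no _ | no u≮z = ⊥-elim (u≮z y<z)
  countBelow-< {y} {z} y<z (u ∷ L) (there y∈) with u <? y | u <? z
  ... | yes _ | yes _ = ℕ.s≤s (countBelow-< y<z L y∈)
  ... | yes u<y | no u≮z = ⊥-elim (u≮z (<-trans u<y y<z))
  ... | no _ | yes _ = ℕ.m≤n⇒m≤1+n (countBelow-< y<z L y∈)
  ... | no _ | no _ = countBelow-< y<z L y∈

  LinkedToLargestBelow : RTree → List A → Set
  LinkedToLargestBelow S L = ∀ z y → z ∈ L → LargestBelow L z y → parent S z ≡ just y

  chain-above-≤ : ∀ {S L} → L ⊆ nodes S → LinkedToLargestBelow S L →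
    ∀ n {t x z} → countBelow z L ℕ.≤ n → x ∈ L → z ∈ L → t ≤ x → x ≤ z → Above S t x z
  chain-above-≤ L⊆S linked n _ x∈ _ t≤x (inj₁ refl) = node (L⊆S x∈) t≤x
  chain-above-≤ {S} {L} L⊆S linked n {t} {x} {z} count≤n x∈ z∈ t≤x (inj₂ x<z) with largestBelow? L z
  ... | inj₂ none = ⊥-elim (none x x∈ x<z)
  ... | inj₁ (y , lb@(y∈ , y<z , y-max)) with n
  ...   | zero = ⊥-elim (ℕ.n≮0 (ℕ.<-≤-trans (countBelow-< y<z L y∈) count≤n))
  ...   | suc n' =
    chain-above-≤ L⊆S linked n' (ℕ.≤-pred (ℕ.≤-trans (countBelow-< y<z L y∈) count≤n)) x∈ y∈ t≤x x≤y
    ⨾ flip (arc (L⊆S z∈) (L⊆S y∈) (linked z y z∈ lb) (≤-trans t≤x (inj₂ x<z)) (≤-trans t≤x x≤y))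
    where x≤y = y-max x x∈ x<z

  chain-above : ∀ {S L} → L ⊆ nodes S → LinkedToLargestBelow S L →
    ∀ {t x y} → x ∈ L → y ∈ L → t ≤ x → t ≤ y → Above S t x y
  chain-above {L = L} L⊆S linked {x = x} {y} x∈ y∈ t≤x t≤y with compare x y
  ... | tri< x<y _ _ = chain-above-≤ L⊆S linked (countBelow y L) ℕ.≤-refl x∈ y∈ t≤x (inj₂ x<y)
  ... | tri≈ _ refl _ = node (L⊆S x∈) t≤x
  ... | tri> _ _ y<x = flip (chain-above-≤ L⊆S linked (countBelow x L) ℕ.≤-refl y∈ x∈ t≤y (inj₂ y<x))

  module Merge {T1 T2 T : RTree} {v w : A} (heap₁ : IsHeapOrdered T1) (heap₂ : IsHeapOrdered T2)
    (disjoint : ∀ x → x ∈ nodes T1 → x ∉ nodes T2) (v∈T1 : v ∈ nodes T1) (w∈T2 : w ∈ nodes T2)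
    (merge : IsMerge T1 T2 v w T) where

    open IsMerge merge

    P : List A
    P = proj₁ (rootPath-exists (proj₁ heap₁) v∈T1)
    v↑P : RootPath T1 v P
    v↑P = proj₂ (rootPath-exists (proj₁ heap₁) v∈T1)
    Q : List A
    Q = proj₁ (rootPath-exists (proj₁ heap₂) w∈T2)
    w↑Q : RootPath T2 w Q
    w↑Q = proj₂ (rootPath-exists (proj₁ heap₂) w∈T2)

    L : List A
    L = P ++ Q

    T1⊆T : nodes T1 ⊆ nodes T
    T1⊆T x∈ = subst (_ ∈_) (sym mNodes) (∈-++⁺ˡ x∈)
    T2⊆T : nodes T2 ⊆ nodes T
    T2⊆T x∈ = subst (_ ∈_) (sym mNodes) (∈-++⁺ʳ (nodes T1) x∈)
    T⊆T1∪T2 : ∀ {x} → x ∈ nodes T → x ∈ nodes T1 ⊎ x ∈ nodes T2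
    T⊆T1∪T2 x∈ = ∈-++⁻ (nodes T1) (subst (_ ∈_) mNodes x∈)

    P⊆T1 : P ⊆ nodes T1
    P⊆T1 = RootPath-nodes (proj₁ heap₁) v∈T1 v↑P
    Q⊆T2 : Q ⊆ nodes T2
    Q⊆T2 = RootPath-nodes (proj₁ heap₂) w∈T2 w↑Q
    L⊆T : L ⊆ nodes T
    L⊆T x∈ with ∈-++⁻ P x∈
    ... | inj₁ x∈P = T1⊆T (P⊆T1 x∈P)
    ... | inj₂ x∈Q = T2⊆T (Q⊆T2 x∈Q)

    v∈L : v ∈ L
    v∈L = ∈-++⁺ˡ (RootPath-head v↑P)
    w∈L : w ∈ L
    w∈L = ∈-++⁺ʳ P (RootPath-head w↑Q)

    data MergeArc (a c : A) : Set where
      relinked : a ∈ L → LargestBelow L a c → MergeArc a c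
      kept₁    : a ∉ L → a ∈ nodes T1 → parent T1 a ≡ just c → MergeArc a c
      kept₂    : a ∉ L → a ∈ nodes T2 → parent T2 a ≡ just c → MergeArc a c

    merge-arc : ∀ {a c} → a ∈ nodes T → parent T a ≡ just c → MergeArc a c
    merge-arc {a} a∈T a↑c with a ∈? L
    ... | yes a∈L with largestBelow? L a
    ...   | inj₁ (y , lb) = relinked a∈L (subst (LargestBelow L a) y≡c lb)
      where y≡c = just-injective (trans (sym (relink P Q v↑P w↑Q a y a∈L lb)) a↑c)
    ...   | inj₂ none = ⊥-elim (nothing≢just (trans (sym (unlink P Q v↑P w↑Q a a∈L none)) a↑c))
    merge-arc {a} a∈T a↑c | no a∉L with T⊆T1∪T2 a∈T
    ... | inj₁ a∈T1 = kept₁ a∉L a∈T1 (trans (sym (keep₁ P Q v↑P w↑Q a a∈T1 a∉L)) a↑c)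
    ... | inj₂ a∈T2 = kept₂ a∉L a∈T2 (trans (sym (keep₂ P Q v↑P w↑Q a a∈T2 a∉L)) a↑c)

    merge-decreasing : ParentDecreasing T
    merge-decreasing a∈T a↑c with merge-arc a∈T a↑c
    ... | relinked _ (c∈L , c<a , _) = L⊆T c∈L , c<a
    ... | kept₁ _ a∈T1 e = map₁ T1⊆T (heapOrdered⇒decreasing heap₁ a∈T1 e)
    ... | kept₂ _ a∈T2 e = map₁ T2⊆T (heapOrdered⇒decreasing heap₂ a∈T2 e)

    merge-chain : ∀ {t x y} → x ∈ L → y ∈ L → t ≤ x → t ≤ y → Above T t x y
    merge-chain = chain-above L⊆T (λ z y z∈L → relink P Q v↑P w↑Q z y z∈L)

    T1-Above⊆T : Above⊆ T1 T
    T1-Above⊆T = Above-lift T1⊆T lift-arc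
      where
        lift-arc : ArcsAbove T1 T
        lift-arc {a = a} a∈T1 c∈T1 a↑c t≤a t≤c with a ∈? L
        ... | no a∉L = arc (T1⊆T a∈T1) (T1⊆T c∈T1) (trans (keep₁ P Q v↑P w↑Q a a∈T1 a∉L) a↑c) t≤a t≤c
        ... | yes a∈L with ∈-++⁻ P a∈L
        ...   | inj₁ a∈P = merge-chain a∈L (∈-++⁺ˡ (RootPath-parent v↑P a∈P a↑c)) t≤a t≤c
        ...   | inj₂ a∈Q = ⊥-elim (disjoint a a∈T1 (Q⊆T2 a∈Q))

    T2-Above⊆T : Above⊆ T2 T
    T2-Above⊆T = Above-lift T2⊆T lift-arc
      where
        lift-arc : ArcsAbove T2 T
        lift-arc {a = a} a∈T2 c∈T2 a↑c t≤a t≤c with a ∈? L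
        ... | no a∉L = arc (T2⊆T a∈T2) (T2⊆T c∈T2) (trans (keep₂ P Q v↑P w↑Q a a∈T2 a∉L) a↑c) t≤a t≤c
        ... | yes a∈L with ∈-++⁻ P a∈L
        ...   | inj₁ a∈P = ⊥-elim (disjoint a (P⊆T1 a∈P) a∈T2)
        ...   | inj₂ a∈Q = merge-chain a∈L (∈-++⁺ʳ P (RootPath-parent w↑Q a∈Q a↑c)) t≤a t≤c

  module RerootLink {T1' T2' T' : RTree} {v w : A} (rooted₁ : IsRootedTree T1') (rooted₂ : IsRootedTree T2')
    (v∈T1' : v ∈ nodes T1') (w∈T2' : w ∈ nodes T2') (link : IsRerootLink T1' T2' v w T') where

    open IsRerootLink link

    R : List A
    R = proj₁ (rootPath-exists rooted₁ v∈T1')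
    v↑R : RootPath T1' v R
    v↑R = proj₂ (rootPath-exists rooted₁ v∈T1')

    T1'⊆T' : nodes T1' ⊆ nodes T'
    T1'⊆T' x∈ = subst (_ ∈_) (sym rNodes) (∈-++⁺ˡ x∈)
    T2'⊆T' : nodes T2' ⊆ nodes T'
    T2'⊆T' x∈ = subst (_ ∈_) (sym rNodes) (∈-++⁺ʳ (nodes T1') x∈)
    T'⊆T1'∪T2' : ∀ {x} → x ∈ nodes T' → x ∈ nodes T1' ⊎ x ∈ nodes T2'
    T'⊆T1'∪T2' x∈ = ∈-++⁻ (nodes T1') (subst (_ ∈_) rNodes x∈)

    R⊆T1' : R ⊆ nodes T1'
    R⊆T1' = RootPath-nodes rooted₁ v∈T1' v↑R

    data RerootArc (a c : A) : Set where
      kept₂'   : a ∈ nodes T2' → parent T2' a ≡ just c → RerootArc a c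
      kept₁'   : a ∈ nodes T1' → a ∉ R → parent T1' a ≡ just c → RerootArc a c
      reversed : c ∈ R → parent T1' c ≡ just a → RerootArc a c
      linked   : a ≡ v → c ≡ w → RerootArc a c

    reroot-arc : ∀ {a c} → a ∈ nodes T' → parent T' a ≡ just c → RerootArc a c
    reroot-arc {a} a∈T' a↑c with T'⊆T1'∪T2' a∈T'
    ... | inj₂ a∈T2' = kept₂' a∈T2' (trans (sym (keepT₂ a a∈T2')) a↑c)
    ... | inj₁ a∈T1' with a ∈? R
    ...   | no a∉R = kept₁' a∈T1' a∉R (trans (sym (keepT₁ R v↑R a a∈T1' a∉R)) a↑c)
    ...   | yes a∈R with a ≟ v
    ...     | yes refl = linked refl (just-injective (trans (sym a↑c) linkVW))
    ...     | no a≢v with RootPath-child v↑R a∈R a≢v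
    ...       | y , y∈R , y↑a = subst (RerootArc a) y≡c (reversed y∈R y↑a)
      where y≡c = just-injective (trans (sym (reverse R v↑R y a y∈R y↑a)) a↑c)

    T1'-Above⊆T' : Above⊆ T1' T'
    T1'-Above⊆T' = Above-lift T1'⊆T' lift-arc
      where
        lift-arc : ArcsAbove T1' T'
        lift-arc {a = a} a∈T1' c∈T1' a↑c t≤a t≤c with a ∈? R
        ... | yes a∈R = flip (arc (T1'⊆T' c∈T1') (T1'⊆T' a∈T1') (reverse R v↑R a _ a∈R a↑c) t≤c t≤a)
        ... | no a∉R = arc (T1'⊆T' a∈T1') (T1'⊆T' c∈T1') (trans (keepT₁ R v↑R a a∈T1' a∉R) a↑c) t≤a t≤c

    T2'-Above⊆T' : Above⊆ T2' T'
    T2'-Above⊆T' = Above-lift T2'⊆T' λ a∈T2' c∈T2' a↑c →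
      arc (T2'⊆T' a∈T2') (T2'⊆T' c∈T2') (trans (keepT₂ _ a∈T2') a↑c)

    up-T2' : ∀ k {z} → z ∈ nodes T2' → up T' k z ≡ up T2' k z
    up-T2' zero _ = refl
    up-T2' (suc k) {z} z∈T2' with parent T2' z in z↑
    ... | nothing = up-root T' k (trans (keepT₂ z z∈T2') z↑)
    ... | just y = trans (up-parent T' k (trans (keepT₂ z z∈T2') z↑))
                         (up-T2' k (IsRootedTree.parentNode rooted₂ z y z∈T2' z↑))

    ReachesV : A → Set
    ReachesV z = ∃ λ j → up T' j z ≡ just v

    RootPath-reaches-v : ∀ {u R'} → RootPath T1' u R' → R' ⊆ R → ReachesV u → ∀ {z} → z ∈ R' → ReachesV z
    RootPath-reaches-v (atRoot _) _ u↑v (here refl) = u↑v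
    RootPath-reaches-v (stepUp _ _) _ u↑v (here refl) = u↑v
    RootPath-reaches-v {u} (stepUp {y = u'} u↑u' r) R'⊆R (j , u↑v) (there z∈) =
      RootPath-reaches-v r (λ i → R'⊆R (there i)) (suc j , trans (up-parent T' j u'↑u) u↑v) z∈
      where u'↑u = reverse R v↑R u u' (R'⊆R (here refl)) u↑u'

    R-reaches-v : ∀ {z} → z ∈ R → ReachesV z
    R-reaches-v = RootPath-reaches-v v↑R (λ i → i) (0 , refl)

    T1'-reaches-v : ∀ k {z} → z ∈ nodes T1' → up T1' k z ≡ just (IsRootedTree.root rooted₁) → ReachesV z
    T1'-reaches-v zero _ refl =
      let k , v↑ = IsRootedTree.reachRoot rooted₁ v v∈T1' in R-reaches-v (RootPath-ancestor v↑R k v↑)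
    T1'-reaches-v (suc k) {z} z∈T1' z↑ with z ∈? R
    ... | yes z∈R = R-reaches-v z∈R
    ... | no z∉R with up-suc⁻ T1' k z↑
    ...   | y , z↑y , y↑ with T1'-reaches-v k (IsRootedTree.parentNode rooted₁ z y z∈T1' z↑y) y↑
    ...     | j , y↑v = suc j , trans (up-parent T' j (trans (keepT₁ R v↑R z z∈T1' z∉R) z↑y)) y↑v

    reroot-reaches-root : ∀ x → x ∈ nodes T' → ∃ λ k → up T' k x ≡ just (IsRootedTree.root rooted₂)
    reroot-reaches-root x x∈T' with T'⊆T1'∪T2' x∈T'
    ... | inj₂ x∈T2' =
      let k , x↑ = IsRootedTree.reachRoot rooted₂ x x∈T2' in k , trans (up-T2' k x∈T2') x↑
    ... | inj₁ x∈T1' =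
      let k , x↑ = IsRootedTree.reachRoot rooted₁ x x∈T1'
          j , x↑v = T1'-reaches-v k x∈T1' x↑
          i , w↑ = IsRootedTree.reachRoot rooted₂ w w∈T2'
      in j ℕ.+ suc i , (begin
        up T' (j ℕ.+ suc i) x             ≡⟨ up-+ T' j (suc i) x ⟩
        (up T' j x >>= up T' (suc i))     ≡⟨ cong (_>>= up T' (suc i)) x↑v ⟩
        up T' (suc i) v                   ≡⟨ up-parent T' i linkVW ⟩
        up T' i w                         ≡⟨ up-T2' i w∈T2' ⟩
        up T2' i w                        ≡⟨ w↑ ⟩
        just (IsRootedTree.root rooted₂)  ∎)
      where open ≡-Reasoning

    reroot-acyclic : Acyclic T'
    reroot-acyclic = reachesRoot⇒acyclic T' root (trans (keepT₂ root rootNode) rootNoPar) reroot-reaches-root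
      where open IsRootedTree rooted₂

  module MergeRerootLink {T1 T2 T1' T2' T T' : RTree} {v w : A}
    (heap₁ : IsHeapOrdered T1) (heap₂ : IsHeapOrdered T2) (disjoint : ∀ x → x ∈ nodes T1 → x ∉ nodes T2)
    (v∈T1 : v ∈ nodes T1) (w∈T2 : w ∈ nodes T2) (merge : IsMerge T1 T2 v w T)
    (rooted₁ : IsRootedTree T1') (rooted₂ : IsRootedTree T2')
    (T1≈T1' : Equivalent T1 T1') (T2≈T2' : Equivalent T2 T2') (link : IsRerootLink T1' T2' v w T') where

    T1⇔T1' : ∀ x → (x ∈ nodes T1) ⇔ (x ∈ nodes T1')
    T1⇔T1' = proj₁ T1≈T1'
    T2⇔T2' : ∀ x → (x ∈ nodes T2) ⇔ (x ∈ nodes T2')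
    T2⇔T2' = proj₁ T2≈T2'

    w∈T2' : w ∈ nodes T2'
    w∈T2' = Equivalence.to (T2⇔T2' w) w∈T2

    open Merge heap₁ heap₂ disjoint v∈T1 w∈T2 merge public
    open RerootLink rooted₁ rooted₂ (Equivalence.to (T1⇔T1' v) v∈T1) w∈T2' link public

    T1-Above⊆T1' : Above⊆ T1 T1'
    T1-Above⊆T1' = equivalent⇒Above⊆ (proj₁ heap₁) rooted₁ T1≈T1'
    T1'-Above⊆T1 : Above⊆ T1' T1
    T1'-Above⊆T1 = equivalent⇒Above⊆ rooted₁ (proj₁ heap₁) (Equivalent-sym T1≈T1')
    T2-Above⊆T2' : Above⊆ T2 T2'
    T2-Above⊆T2' = equivalent⇒Above⊆ (proj₁ heap₂) rooted₂ T2≈T2'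
    T2'-Above⊆T2 : Above⊆ T2' T2
    T2'-Above⊆T2 = equivalent⇒Above⊆ rooted₂ (proj₁ heap₂) (Equivalent-sym T2≈T2')

    same-nodes : ∀ x → (x ∈ nodes T') ⇔ (x ∈ nodes T)
    same-nodes x = mk⇔ T'⊆T T⊆T'
      where
        T'⊆T : x ∈ nodes T' → x ∈ nodes T
        T'⊆T x∈ with T'⊆T1'∪T2' x∈
        ... | inj₁ x∈T1' = T1⊆T (Equivalence.from (T1⇔T1' x) x∈T1')
        ... | inj₂ x∈T2' = T2⊆T (Equivalence.from (T2⇔T2' x) x∈T2')
        T⊆T' : x ∈ nodes T → x ∈ nodes T'
        T⊆T' x∈ with T⊆T1∪T2 x∈
        ... | inj₁ x∈T1 = T1'⊆T' (Equivalence.to (T1⇔T1' x) x∈T1)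
        ... | inj₂ x∈T2 = T2'⊆T' (Equivalence.to (T2⇔T2' x) x∈T2)

    P-joined-to-v : ∀ {t x} → x ∈ P → t ≤ x → Above T' t v x × t ≤ v
    P-joined-to-v x∈P t≤x =
      let x≤v , v~x = heap-rootPath heap₁ v∈T1 v↑P x∈P
      in T1'-Above⊆T' (T1-Above⊆T1' (v~x t≤x)) , ≤-trans t≤x x≤v

    Q-joined-to-w : ∀ {t x} → x ∈ Q → t ≤ x → Above T' t w x × t ≤ w
    Q-joined-to-w x∈Q t≤x =
      let x≤w , w~x = heap-rootPath heap₂ w∈T2 w↑Q x∈Q
      in T2'-Above⊆T' (T2-Above⊆T2' (w~x t≤x)) , ≤-trans t≤x x≤w

    P-joined-to-Q : ∀ {t x y} → x ∈ P → y ∈ Q → t ≤ x → t ≤ y → Above T' t x y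
    P-joined-to-Q x∈P y∈Q t≤x t≤y =
      let v~x , t≤v = P-joined-to-v x∈P t≤x
          w~y , t≤w = Q-joined-to-w y∈Q t≤y
          v~w = arc (T1'⊆T' (R⊆T1' (RootPath-head v↑R))) (T2'⊆T' w∈T2') (IsRerootLink.linkVW link) t≤v t≤w
      in flip v~x ⨾ v~w ⨾ w~y

    link-chain : ∀ {t x y} → x ∈ L → y ∈ L → t ≤ x → t ≤ y → Above T' t x y
    link-chain x∈L y∈L t≤x t≤y with ∈-++⁻ P x∈L | ∈-++⁻ P y∈L
    ... | inj₁ x∈P | inj₁ y∈P = flip (proj₁ (P-joined-to-v x∈P t≤x)) ⨾ proj₁ (P-joined-to-v y∈P t≤y)
    ... | inj₁ x∈P | inj₂ y∈Q = P-joined-to-Q x∈P y∈Q t≤x t≤y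
    ... | inj₂ x∈Q | inj₁ y∈P = flip (P-joined-to-Q y∈P x∈Q t≤y t≤x)
    ... | inj₂ x∈Q | inj₂ y∈Q = flip (proj₁ (Q-joined-to-w x∈Q t≤x)) ⨾ proj₁ (Q-joined-to-w y∈Q t≤y)

    T'-Above⊆T : Above⊆ T' T
    T'-Above⊆T = Above-lift (Equivalence.to (same-nodes _)) lift-arc
      where
        lift-arc : ArcsAbove T' T
        lift-arc a∈T' _ a↑c t≤a t≤c with reroot-arc a∈T' a↑c
        ... | kept₂' a∈T2' e = T2-Above⊆T (T2'-Above⊆T2 (tree-arc rooted₂ a∈T2' e t≤a t≤c))
        ... | kept₁' a∈T1' _ e = T1-Above⊆T (T1'-Above⊆T1 (tree-arc rooted₁ a∈T1' e t≤a t≤c))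
        ... | reversed c∈R e = flip (T1-Above⊆T (T1'-Above⊆T1 (tree-arc rooted₁ (R⊆T1' c∈R) e t≤c t≤a)))
        ... | linked refl refl = merge-chain v∈L w∈L t≤a t≤c

    T-Above⊆T' : Above⊆ T T'
    T-Above⊆T' = Above-lift (Equivalence.from (same-nodes _)) lift-arc
      where
        lift-arc : ArcsAbove T T'
        lift-arc a∈T _ a↑c t≤a t≤c with merge-arc a∈T a↑c
        ... | relinked a∈L (c∈L , _) = link-chain a∈L c∈L t≤a t≤c
        ... | kept₁ _ a∈T1 e = T1'-Above⊆T' (T1-Above⊆T1' (tree-arc (proj₁ heap₁) a∈T1 e t≤a t≤c))
        ... | kept₂ _ a∈T2 e = T2'-Above⊆T' (T2-Above⊆T2' (tree-arc (proj₁ heap₂) a∈T2 e t≤a t≤c))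

lemma5 : {A : Set} (_<_ : Rel A 0ℓ) → IsStrictTotalOrder _≡_ _<_ →
    let open Trees _<_ in
    (T1 T2 T1' T2' T T' : RTree) (v w : A) →
    IsHeapOrdered T1 → IsHeapOrdered T2 →
    (∀ x → x ∈ nodes T1 → x ∉ nodes T2) →
    v ∈ nodes T1 → w ∈ nodes T2 →
    IsMerge T1 T2 v w T →
    IsRootedTree T1' → IsRootedTree T2' →
    Equivalent T1 T1' → Equivalent T2 T2' →
    IsRerootLink T1' T2' v w T' →
    Equivalent T' T
lemma5 _<_ sto _ _ _ _ _ _ _ _ heap₁ heap₂ disjoint v∈T1 w∈T2 merge rooted₁ rooted₂ T1≈T1' T2≈T2' link =
  sameAbove⇒equivalent reroot-acyclic (decreasing⇒acyclic merge-decreasing) same-nodes T'-Above⊆T T-Above⊆T'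
  where
    open OrderedTrees _<_ sto
    open MergeRerootLink heap₁ heap₂ disjoint v∈T1 w∈T2 merge rooted₁ rooted₂ T1≈T1' T2≈T2' link
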